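{- Let $D\subseteq\mathbb{R}^n$ be a symmetric set such that $D\cap(D+z)=\emptyset$ for all $z\in\mathbb{Z}^n\setminus\{0\}$, and let $x\in D$. Then for all $1\leq i,j\leq n$, if $x_i-x_j\in\mathbb{Z}$ then $x_i=x_j$.
   Context: A set $D\subseteq\mathbb{R}^n$ is symmetric if for every permutation $\pi\in S_n$ and every $x\in\mathbb{R}^n$, $x\in D$ if and only if $\pi(x)\in D$, where $\pi(x)$ permutes the coordinates of $x$. -}

module Defs where

open import Level using (Level; _⊔_; suc)
open import Algebra.Bundles using (CommutativeRing)
open import Data.Nat using (ℕ; zero) renaming (suc to sucℕ)
open import Data.Integer using (ℤ; +_; -[1+_]; 0ℤ)
open import Data.Fin using (Fin)
open import Data.Fin.Permutation using (Permutation′; _⟨$⟩ʳ_)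
open import Data.Product using (Σ; ∃; _×_)
open import Relation.Binary.PropositionalEquality using (_≡_)
open import Relation.Nullary using (¬_)
open import Relation.Unary using (Pred)

-- The ambient "real line" is an arbitrary commutative ring R (ℝ is an instance).
module _ {c ℓ : Level} (R : CommutativeRing c ℓ) where
  open CommutativeRing R

  ιℕ : ℕ → Carrier
  ιℕ zero = 0#
  ιℕ (sucℕ n) = 1# + ιℕ n

  ιℤ : ℤ → Carrier
  ιℤ (+ n) = ιℕ n
  ιℤ (-[1+ n ]) = - (ιℕ (sucℕ n))

  Point : ℕ → Set c
  Point n = Fin n → Carrier

  permute : {n : ℕ} → Permutation′ n → Point n → Point n
  permute π x i = x (π ⟨$⟩ʳ i)

  Symmetric : {n : ℕ} {ℓD : Level} → Pred (Point n) ℓD → Set (c ⊔ ℓD)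
  Symmetric {n} D = (π : Permutation′ n) (x : Point n) →
    (D x → D (permute π x)) × (D (permute π x) → D x)

  translate : {n : ℕ} {ℓD : Level} → Pred (Point n) ℓD → (Fin n → ℤ) → Pred (Point n) (c ⊔ ℓ ⊔ ℓD)
  translate D z y = Σ (Point _) λ d → D d × (∀ i → y i ≈ d i + ιℤ (z i))

  LatticeDisjoint : {n : ℕ} {ℓD : Level} → Pred (Point n) ℓD → Set (c ⊔ ℓ ⊔ ℓD)
  LatticeDisjoint {n} D = (z : Fin n → ℤ) → ¬ (∀ i → z i ≡ 0ℤ) →
    (y : Point n) → ¬ (D y × translate D z y)

  IsInteger : Carrier → Set (ℓ ⊔ Level.zero)
  IsInteger a = ∃ λ (k : ℤ) → a ≈ ιℤ k

{-# OPTIONS --safe #-}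
-- If x ∈ D and x i − x j = k ∈ ℤ, then x is the translate of its transposed copy
-- π(x) ∈ D by the integer vector k (eᵢ − eⱼ). Lattice disjointness forbids a nonzero
-- translation between two points of D, so k = 0 and x i = x j.
module Submission where

open import Defs
open import Level using (Level)
open import Algebra.Bundles using (CommutativeRing)
import Algebra.Properties.AbelianGroup as AbelianGroupProperties
open import Data.Nat as ℕ using (ℕ)
open import Data.Fin using (Fin; _≟_)
open import Data.Fin.Permutation using (Permutation′; transpose)
open import Data.Integer as ℤ using (ℤ; +_; -[1+_]; 0ℤ)
open import Data.Empty using (⊥-elim)
open import Data.Product using (_,_; proj₁)
open import Relation.Nullary using (yes; no)
open import Relation.Nullary.Decidable using (decidable-stable)
open import Relation.Binary.PropositionalEquality as ≡ using (_≡_)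
open import Relation.Unary using (Pred)
import Relation.Binary.Reasoning.Setoid as SetoidReasoning

-- The integer vector k (eᵢ − eⱼ); for i ≡ j it is k eᵢ, which is all that is used then.
differenceVector : {n : ℕ} → ℤ → Fin n → Fin n → Fin n → ℤ
differenceVector k i j m with m ≟ i
... | yes _ = k
... | no _ with m ≟ j
...   | yes _ = ℤ.- k
...   | no _  = 0ℤ

differenceVector-at-i : {n : ℕ} (k : ℤ) (i j : Fin n) → differenceVector k i j i ≡ k
differenceVector-at-i k i j with i ≟ i
... | yes _  = ≡.refl
... | no i≢i = ⊥-elim (i≢i ≡.refl)

module _ {c ℓ : Level} (R : CommutativeRing c ℓ) where
  open CommutativeRing R
  open AbelianGroupProperties +-abelianGroup
    using (//-rightDividesˡ; //-rightDividesʳ; ε⁻¹≈ε; ⁻¹-involutive)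
  open SetoidReasoning setoid

  x-y≈d⇒x≈y+d : ∀ {x y d} → x - y ≈ d → x ≈ y + d
  x-y≈d⇒x≈y+d {x} {y} {d} x-y≈d = begin
    x           ≈⟨ //-rightDividesˡ y x ⟨
    (x - y) + y ≈⟨ +-congʳ x-y≈d ⟩
    d + y       ≈⟨ +-comm d y ⟩
    y + d       ∎

  x-y≈d⇒y≈x-d : ∀ {x y d} → x - y ≈ d → y ≈ x - d
  x-y≈d⇒y≈x-d {x} {y} {d} x-y≈d = begin
    y           ≈⟨ //-rightDividesʳ d y ⟨
    (y + d) - d ≈⟨ +-congʳ (x-y≈d⇒x≈y+d x-y≈d) ⟨
    x - d       ∎

  ιℤ-neg : ∀ k → ιℤ R (ℤ.- k) ≈ - ιℤ R k
  ιℤ-neg (+ ℕ.zero)  = sym ε⁻¹≈ε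
  ιℤ-neg (+ ℕ.suc n) = refl
  ιℤ-neg -[1+ n ]    = sym (⁻¹-involutive (ιℕ R (ℕ.suc n)))

  x≈transpose+differenceVector : ∀ {n} (x : Point R n) (i j : Fin n) (k : ℤ) →
    x i - x j ≈ ιℤ R k →
    ∀ m → x m ≈ permute R (transpose i j) x m + ιℤ R (differenceVector k i j m)
  x≈transpose+differenceVector x i j k xi-xj≈k m with m ≟ i
  ... | yes ≡.refl = x-y≈d⇒x≈y+d xi-xj≈k
  ... | no _ with m ≟ j
  ...   | yes ≡.refl = trans (x-y≈d⇒y≈x-d xi-xj≈k) (+-congˡ (sym (ιℤ-neg k)))
  ...   | no _       = sym (+-identityʳ (x m))

  permuted+integerShift⇒shift≡0 : ∀ {n ℓD} {D : Pred (Point R n) ℓD} →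
    Symmetric R D → LatticeDisjoint R D →
    ∀ {x} → D x → (π : Permutation′ n) (z : Fin n → ℤ) →
    (∀ m → x m ≈ permute R π x m + ιℤ R (z m)) → ∀ m → z m ≡ 0ℤ
  -- LatticeDisjoint only refutes z m ≢ 0; decidability of ℤ-equality removes the ¬¬.
  permuted+integerShift⇒shift≡0 symmetric disjoint {x} x∈D π z x≈πx+z m =
    decidable-stable (z m ℤ.≟ 0ℤ) λ zm≢0 →
      disjoint z (λ z≡0 → zm≢0 (z≡0 m)) x
        (x∈D , permute R π x , proj₁ (symmetric π x) x∈D , x≈πx+z)

lemma2p3 : {c ℓ ℓD : Level} (R : CommutativeRing c ℓ) (n : ℕ)
    (D : Pred (Point R n) ℓD) → Symmetric R D → LatticeDisjoint R D →
    (x : Point R n) → D x → (i j : Fin n) →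
    IsInteger R (CommutativeRing._-_ R (x i) (x j)) →
    CommutativeRing._≈_ R (x i) (x j)
lemma2p3 R n D symmetric disjoint x x∈D i j (k , xi-xj≈k) = begin
  x i                ≈⟨ x-y≈d⇒x≈y+d R xi-xj≈k ⟩
  x j + ιℤ R k       ≡⟨ ≡.cong (λ k → x j + ιℤ R k) k≡0 ⟩
  x j + ιℤ R 0ℤ      ≈⟨ +-identityʳ (x j) ⟩
  x j                ∎
  where
  open CommutativeRing R
  open SetoidReasoning setoid

  k≡0 : k ≡ 0ℤ
  k≡0 = ≡.trans (≡.sym (differenceVector-at-i k i j))
    (permuted+integerShift⇒shift≡0 R symmetric disjoint x∈D (transpose i j)
      (differenceVector k i j) (x≈transpose+differenceVector R x i j k xi-xj≈k) i)
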